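{- Let $0<c<1$. If $\mathcal G=\{G_1,\dots,G_t\}$ is a family of $(p,\beta)$-jumbled graphs on the same vertex set $V$ with $|V|\ge c^{ -1}t^{1/2}\beta p^{ -1}$, then there is a vertex $v\in V$ with $d_{G_i}(v)\ge(1-c)p|V|$ for each $i\in[t]$.
   Context: For a graph $G$ and $X,Y\subseteq V(G)$, $e(X,Y)=\#\{(x,y)\in X\times Y:xy\in E(G)\}$. For $0<p<1\le\beta$, $G$ is $(p,\beta)$-jumbled if $|e(X,Y)-p|X||Y||\le\beta|X|^{1/2}|Y|^{1/2}$ for all $X,Y\subseteq V(G)$. $d_{G_i}(v)$ is the degree of $v$ in $G_i$.
   Formalization: The parameters c, p and β take rational values. -}

module Defs where

open import Data.Nat as ℕ using (ℕ; zero; suc)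
open import Data.Integer using (+_)
open import Data.Bool using (Bool; true; false; _∧_; T; not)
open import Data.Fin using (Fin; zero; suc)
open import Data.Vec using (Vec; lookup)
open import Data.Rational using (ℚ; _/_; _*_; _-_; _≤_; _<_; 0ℚ; 1ℚ)
open import Data.Product using (_×_)
open import Relation.Binary.PropositionalEquality using (_≡_)

record Graph (n : ℕ) : Set where
  field
    adj     : Fin n → Fin n → Bool
    adj-sym : ∀ x y → adj x y ≡ adj y x
    loopless : ∀ x → adj x x ≡ false
open Graph public

sumFin : (n : ℕ) → (Fin n → ℕ) → ℕ
sumFin zero    f = 0
sumFin (suc n) f = f zero ℕ.+ sumFin n (λ i → f (suc i))

ind : Bool → ℕ
ind true  = 1
ind false = 0

Subset : ℕ → Set
Subset n = Vec Bool n

card : {n : ℕ} → Subset n → ℕ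
card {n} X = sumFin n (λ x → ind (lookup X x))

-- e(X,Y) = #{(x,y) ∈ X × Y : xy ∈ E(G)}  (ordered pairs)
e : {n : ℕ} → Graph n → Subset n → Subset n → ℕ
e {n} G X Y = sumFin n (λ x → sumFin n (λ y →
                ind (lookup X x ∧ lookup Y y ∧ adj G x y)))

deg : {n : ℕ} → Graph n → Fin n → ℕ
deg {n} G v = sumFin n (λ y → ind (adj G v y))

ℕ→ℚ : ℕ → ℚ
ℕ→ℚ k = + k / 1

-- (p,β)-jumbled: |e(X,Y) - p|X||Y|| ≤ β |X|^{1/2} |Y|^{1/2} for all X, Y,
-- stated in the equivalent squared form (both sides are nonnegative):
-- (e(X,Y) - p|X||Y|)^2 ≤ β^2 |X||Y|.
Jumbled : {n : ℕ} → ℚ → ℚ → Graph n → Set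
Jumbled {n} p β G = ∀ (X Y : Subset n) →
  let d = ℕ→ℚ (e G X Y) - p * ℕ→ℚ (card X) * ℕ→ℚ (card Y) in
  d * d ≤ β * β * (ℕ→ℚ (card X) * ℕ→ℚ (card Y))

{-# OPTIONS --safe #-}
module Submission where

-- If no vertex has high degree in every G_i, pick for each vertex v an index low v
-- with d_{G_{low v}}(v) < (1 - c) p n. The fibres X_i of low partition V, so some X_i
-- has at least n / t vertices. In G_i the edges leaving X_i fall short of the expected
-- p |X_i| n by more than c p |X_i| n, and jumbledness (applied to X_i and V) bounds the
-- square of that shortfall by β² |X_i| n; hence c² p² |X_i| n < β², and |X_i| ≥ n / t
-- turns this into (c p n)² < t β², contradicting the hypothesis. Everything is finite
-- and decidable, so the contradiction yields the vertex constructively.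

open import Defs
open import Data.Nat using (ℕ; NonZero)
open import Data.Fin using (Fin)
open import Data.Product using (Σ; _×_)
open import Data.Rational using (ℚ; _*_; _-_; _≤_; _<_; 0ℚ; 1ℚ)

open import Algebra.Bundles using (Ring)
open import Data.Bool using (true; false; _∧_)
open import Data.Empty using (⊥; ⊥-elim)
open import Data.Fin using (zero; suc; _≟_)
import Data.Fin.Properties as FinP
import Data.Integer as ℤ
import Data.Integer.Properties as ℤP
open import Data.Nat using (zero; suc)
import Data.Nat as ℕ
import Data.Nat.Coprimality as Coprime
import Data.Nat.Properties as ℕP
open import Data.Product using (_,_; proj₁; proj₂)
import Data.Product as Product
open import Data.Sum using (_⊎_; inj₁; inj₂)
open import Data.Rational using (mkℚ; _+_; -_)
import Data.Rational as ℚ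
import Data.Rational.Properties as ℚP
open import Data.Rational.Solver using (module +-*-Solver)
open import Data.Vec using (_∷_; lookup; replicate; tabulate)
open import Data.Vec.Functional using (Vector)
open import Data.Vec.Properties using (lookup-replicate; lookup∘tabulate)
open import Function using (_∘_; id)
open import Relation.Binary.PropositionalEquality
open import Relation.Nullary using (Dec; yes; no; does; ¬_; contradiction)

open import Algebra.Properties.CommutativeSemigroup ℕP.+-commutativeSemigroup
  using (interchange)
open import Algebra.Properties.Semiring.Sum (Ring.semiring ℚP.+-*-ring)
  using (sum; *-distribʳ-sum)

ℕ→ℚ≡mkℚ : ∀ k → ℕ→ℚ k ≡ mkℚ (ℤ.+ k) 0 (Coprime.sym (Coprime.1-coprimeTo k))
ℕ→ℚ≡mkℚ k = ℚP.normalize-coprime _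

ℕ→ℚ-+ : ∀ a b → ℕ→ℚ (a ℕ.+ b) ≡ ℕ→ℚ a + ℕ→ℚ b
ℕ→ℚ-+ a b rewrite ℕ→ℚ≡mkℚ a | ℕ→ℚ≡mkℚ b =
  ℚP./-cong {p₂ = ℤ.+ a ℤ.* ℤ.+ 1 ℤ.+ ℤ.+ b ℤ.* ℤ.+ 1} {q₂ = 1}
    (trans (ℤP.pos-+ a b) (sym (cong₂ ℤ._+_ (ℤP.*-identityʳ (ℤ.+ a)) (ℤP.*-identityʳ (ℤ.+ b)))))
    refl

ℕ→ℚ-* : ∀ a b → ℕ→ℚ (a ℕ.* b) ≡ ℕ→ℚ a * ℕ→ℚ b
ℕ→ℚ-* a b rewrite ℕ→ℚ≡mkℚ a | ℕ→ℚ≡mkℚ b =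
  ℚP./-cong {p₂ = ℤ.+ a ℤ.* ℤ.+ b} {q₂ = 1} (ℤP.pos-* a b) refl

ℕ→ℚ-mono-≤ : ∀ {a b} → a ℕ.≤ b → ℕ→ℚ a ≤ ℕ→ℚ b
ℕ→ℚ-mono-≤ {a} {b} a≤b rewrite ℕ→ℚ≡mkℚ a | ℕ→ℚ≡mkℚ b =
  ℚ.*≤* (subst₂ ℤ._≤_ (sym (ℤP.*-identityʳ (ℤ.+ a))) (sym (ℤP.*-identityʳ (ℤ.+ b)))
                       (ℤ.+≤+ a≤b))

ℕ→ℚ-mono-< : ∀ {a b} → a ℕ.< b → ℕ→ℚ a < ℕ→ℚ b
ℕ→ℚ-mono-< {a} {b} a<b rewrite ℕ→ℚ≡mkℚ a | ℕ→ℚ≡mkℚ b =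
  ℚ.*<* (subst₂ ℤ._<_ (sym (ℤP.*-identityʳ (ℤ.+ a))) (sym (ℤP.*-identityʳ (ℤ.+ b)))
                       (ℤ.+<+ a<b))

*-pos : ∀ {p q} → 0ℚ < p → 0ℚ < q → 0ℚ < p * q
*-pos {p} {q} 0<p 0<q =
  ℚP.positive⁻¹ _ {{ℚP.pos*pos⇒pos p {{ℚ.positive 0<p}} q {{ℚ.positive 0<q}}}}

*-nonNeg : ∀ {p q} → 0ℚ ≤ p → 0ℚ ≤ q → 0ℚ ≤ p * q
*-nonNeg {p} {q} 0≤p 0≤q =
  ℚP.nonNegative⁻¹ _ {{ℚP.nonNeg*nonNeg⇒nonNeg p {{ℚ.nonNegative 0≤p}} q {{ℚ.nonNegative 0≤q}}}}

square-mono-< : ∀ {p q} → 0ℚ ≤ p → p < q → p * p < q * q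
square-mono-< {p} {q} 0≤p p<q = ℚP.≤-<-trans
  (ℚP.*-monoˡ-≤-nonNeg p {{ℚ.nonNegative 0≤p}} (ℚP.<⇒≤ p<q))
  (ℚP.*-monoˡ-<-pos q {{ℚ.positive (ℚP.≤-<-trans 0≤p p<q)}} p<q)

sum-mono-≤ : ∀ {n} {f g : Vector ℚ n} → (∀ i → f i ≤ g i) → sum f ≤ sum g
sum-mono-≤ {zero}  f≤g = ℚP.≤-refl
sum-mono-≤ {suc n} f≤g = ℚP.+-mono-≤ (f≤g zero) (sum-mono-≤ (f≤g ∘ suc))

sum-mono-< : ∀ {n} {f g : Vector ℚ n} → (∀ i → f i ≤ g i) → ∀ i → f i < g i → sum f < sum g
sum-mono-< f≤g zero    f<g = ℚP.+-mono-<-≤ f<g (sum-mono-≤ (f≤g ∘ suc))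
sum-mono-< f≤g (suc i) f<g = ℚP.+-mono-≤-< (f≤g zero) (sum-mono-< (f≤g ∘ suc) i f<g)

ℕ→ℚ-sumFin : ∀ n (f : Fin n → ℕ) → ℕ→ℚ (sumFin n f) ≡ sum (ℕ→ℚ ∘ f)
ℕ→ℚ-sumFin zero    f = refl
ℕ→ℚ-sumFin (suc n) f =
  trans (ℕ→ℚ-+ (f zero) _) (cong (ℕ→ℚ (f zero) +_) (ℕ→ℚ-sumFin n (f ∘ suc)))

sumFin-cong : ∀ n {f g : Fin n → ℕ} → (∀ i → f i ≡ g i) → sumFin n f ≡ sumFin n g
sumFin-cong zero    f≗g = refl
sumFin-cong (suc n) f≗g = cong₂ ℕ._+_ (f≗g zero) (sumFin-cong n (f≗g ∘ suc))

sumFin-zero : ∀ n → sumFin n (λ _ → 0) ≡ 0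
sumFin-zero zero    = refl
sumFin-zero (suc n) = sumFin-zero n

sumFin-+ : ∀ n (f g : Fin n → ℕ) →
  sumFin n (λ i → f i ℕ.+ g i) ≡ sumFin n f ℕ.+ sumFin n g
sumFin-+ zero    f g = refl
sumFin-+ (suc n) f g = trans
  (cong (f zero ℕ.+ g zero ℕ.+_) (sumFin-+ n (f ∘ suc) (g ∘ suc)))
  (interchange (f zero) (g zero) (sumFin n (f ∘ suc)) (sumFin n (g ∘ suc)))

sumFin-ind-≟ : ∀ {t} (j : Fin t) → sumFin t (λ i → ind (does (j ≟ i))) ≡ 1
sumFin-ind-≟ {suc t} zero    = cong suc (sumFin-zero t)
sumFin-ind-≟ {suc t} (suc j) = sumFin-ind-≟ j

sumFin≤t*largest : ∀ t .{{_ : NonZero t}} (f : Fin t → ℕ) →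
  Σ (Fin t) (λ i → sumFin t f ℕ.≤ t ℕ.* f i)
sumFin≤t*largest 1 f = zero , ℕP.≤-refl
sumFin≤t*largest (suc t@(suc _)) f with sumFin≤t*largest t (f ∘ suc)
... | j , rest≤t*fj with f zero ℕ.≤? f (suc j)
...   | yes f₀≤fj = suc j , ℕP.+-mono-≤ f₀≤fj rest≤t*fj
...   | no  f₀≰fj = zero , ℕP.+-monoʳ-≤ (f zero)
                      (ℕP.≤-trans rest≤t*fj (ℕP.*-monoʳ-≤ t (ℕP.<⇒≤ (ℕP.≰⇒> f₀≰fj))))

∃∀⊎∀∃¬ : ∀ {n t p} {P : Fin n → Fin t → Set p} → (∀ v i → Dec (P v i)) →
  Σ (Fin n) (λ v → ∀ i → P v i) ⊎ Σ (Fin n → Fin t) (λ f → ∀ v → ¬ P v (f v))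
∃∀⊎∀∃¬ {t = t} {P = P} P? with FinP.any? (λ v → FinP.all? (P? v))
... | yes ∃∀P = inj₁ ∃∀P
... | no ¬∃∀P = inj₂ (proj₁ ∘ refuter , proj₂ ∘ refuter)
  where
  refuter : ∀ v → Σ (Fin t) (λ i → ¬ P v i)
  refuter v = FinP.¬∀⟶∃¬ t _ (P? v) (λ ∀P → ¬∃∀P (v , ∀P))

⊤ : ∀ {n} → Subset n
⊤ {n} = replicate n true

card-⊤ : ∀ n → card (⊤ {n}) ≡ n
card-⊤ zero    = refl
card-⊤ (suc n) = cong suc (card-⊤ n)

card-pos⇒∃ : ∀ {n} (X : Subset n) → 0 ℕ.< card X → Σ (Fin n) (λ x → lookup X x ≡ true)
card-pos⇒∃ (true  ∷ X) _     = zero , refl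
card-pos⇒∃ (false ∷ X) 0<∣X∣ = Product.map suc id (card-pos⇒∃ X 0<∣X∣)

fibre : ∀ {n t} → (Fin n → Fin t) → Fin t → Subset n
fibre f i = tabulate (λ v → does (f v ≟ i))

fibre-sound : ∀ {n t} (f : Fin n → Fin t) i v → lookup (fibre f i) v ≡ true → f v ≡ i
fibre-sound f i v v∈fibre with f v ≟ i | lookup∘tabulate (λ u → does (f u ≟ i)) v
... | yes fv≡i | _   = fv≡i
... | no  _    | eq  = contradiction (trans (sym v∈fibre) eq) λ ()

sumFin-card-fibre : ∀ {n t} (f : Fin n → Fin t) → sumFin t (card ∘ fibre f) ≡ n
sumFin-card-fibre {zero}  {t} f = sumFin-zero t
sumFin-card-fibre {suc n} {t} f = begin
  sumFin t (λ i → ind (does (f zero ≟ i)) ℕ.+ card (fibre (f ∘ suc) i))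
    ≡⟨ sumFin-+ t _ _ ⟩
  sumFin t (λ i → ind (does (f zero ≟ i))) ℕ.+ sumFin t (card ∘ fibre (f ∘ suc))
    ≡⟨ cong₂ ℕ._+_ (sumFin-ind-≟ (f zero)) (sumFin-card-fibre (f ∘ suc)) ⟩
  suc n ∎
  where open ≡-Reasoning

e[X,⊤]≡∑deg : ∀ {n} (G : Graph n) (X : Subset n) →
  e G X ⊤ ≡ sumFin n (λ x → ind (lookup X x) ℕ.* deg G x)
e[X,⊤]≡∑deg {n} G X = sumFin-cong n edges-from
  where
  edges-from : ∀ x → sumFin n (λ y → ind (lookup X x ∧ lookup ⊤ y ∧ adj G x y))
                   ≡ ind (lookup X x) ℕ.* deg G x
  edges-from x with lookup X x
  ... | true  = trans (sumFin-cong n (λ y → cong (λ b → ind (b ∧ adj G x y)) (lookup-replicate y true)))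
                      (sym (ℕP.+-identityʳ (deg G x)))
  ... | false = sumFin-zero n

ind*-< : ∀ {b} d B → b ≡ true → ℕ→ℚ d < B → ℕ→ℚ (ind b ℕ.* d) < ℕ→ℚ (ind b) * B
ind*-< d B refl d<B rewrite ℕP.*-identityˡ d | ℚP.*-identityˡ B = d<B

ind*-≤ : ∀ b d B → (b ≡ true → ℕ→ℚ d < B) → ℕ→ℚ (ind b ℕ.* d) ≤ ℕ→ℚ (ind b) * B
ind*-≤ true  d B d<B = ℚP.<⇒≤ (ind*-< d B refl (d<B refl))
ind*-≤ false d B _   = ℚP.≤-reflexive (sym (ℚP.*-zeroˡ B))

e[X,⊤]<card*B : ∀ {n} (G : Graph n) (X : Subset n) (B : ℚ) →
  (∀ x → lookup X x ≡ true → ℕ→ℚ (deg G x) < B) →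
  (x₀ : Fin n) → lookup X x₀ ≡ true →
  ℕ→ℚ (e G X ⊤) < ℕ→ℚ (card X) * B
e[X,⊤]<card*B {n} G X B deg<B x₀ x₀∈X = begin-strict
  ℕ→ℚ (e G X ⊤)                           ≡⟨ cong ℕ→ℚ (e[X,⊤]≡∑deg G X) ⟩
  ℕ→ℚ (sumFin n degX)                      ≡⟨ ℕ→ℚ-sumFin n degX ⟩
  sum (ℕ→ℚ ∘ degX)                         <⟨ sum-mono-< termwise-≤ x₀ strict-at-x₀ ⟩
  sum (λ x → ℕ→ℚ (ind (lookup X x)) * B)   ≡⟨ *-distribʳ-sum B (ℕ→ℚ ∘ ind ∘ lookup X) ⟨
  sum (ℕ→ℚ ∘ ind ∘ lookup X) * B           ≡⟨ cong (_* B) (ℕ→ℚ-sumFin n (ind ∘ lookup X)) ⟨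
  ℕ→ℚ (card X) * B                         ∎
  where
  open ℚP.≤-Reasoning
  degX : Fin n → ℕ
  degX x = ind (lookup X x) ℕ.* deg G x
  termwise-≤ : ∀ x → ℕ→ℚ (degX x) ≤ ℕ→ℚ (ind (lookup X x)) * B
  termwise-≤ x = ind*-≤ (lookup X x) (deg G x) B (deg<B x)
  strict-at-x₀ : ℕ→ℚ (degX x₀) < ℕ→ℚ (ind (lookup X x₀)) * B
  strict-at-x₀ = ind*-< (deg G x₀) B x₀∈X (deg<B x₀ x₀∈X)

Jumbled⇒deviation[X,⊤] : ∀ {n p β} (G : Graph n) → Jumbled p β G → (X : Subset n) →
  let k = ℕ→ℚ (card X); N = ℕ→ℚ n; d = ℕ→ℚ (e G X ⊤) - p * k * N in
  d * d ≤ β * β * (k * N)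
Jumbled⇒deviation[X,⊤] {n} {p} {β} G jumbled X = subst
  (λ m → let k = ℕ→ℚ (card X); d = ℕ→ℚ (e G X ⊤) - p * k * ℕ→ℚ m in
         d * d ≤ β * β * (k * ℕ→ℚ m))
  (card-⊤ n) (jumbled X ⊤)

deficit⇒c²p²kN<β² : ∀ {c p β E k N} → 0ℚ ≤ c * p → 0ℚ < k * N →
  (E - p * k * N) * (E - p * k * N) ≤ β * β * (k * N) →
  E < k * ((1ℚ - c) * p * N) →
  c * p * (c * p) * (k * N) < β * β
deficit⇒c²p²kN<β² {c} {p} {β} {E} {k} {N} 0≤cp 0<kN deviation E<kB =
  ℚP.*-cancelʳ-<-nonNeg (k * N) {{ℚ.nonNegative (ℚP.<⇒≤ 0<kN)}} (begin-strict
    c * p * (c * p) * (k * N) * (k * N)  ≡⟨ solve 4 (λ c p k N →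
                                               c :* p :* (c :* p) :* (k :* N) :* (k :* N)
                                            := c :* p :* (k :* N) :* (c :* p :* (k :* N))) refl c p k N ⟩
    a * a                                <⟨ square-mono-< (*-nonNeg 0≤cp (ℚP.<⇒≤ 0<kN)) a<D ⟩
    D * D                                ≡⟨ solve 4 (λ E p k N →
                                               (p :* k :* N :- E) :* (p :* k :* N :- E)
                                            := (E :- p :* k :* N) :* (E :- p :* k :* N)) refl E p k N ⟩
    (E - p * k * N) * (E - p * k * N)    ≤⟨ deviation ⟩
    β * β * (k * N)                      ∎)
  where
  open ℚP.≤-Reasoning
  open +-*-Solver
  a D : ℚ
  a = c * p * (k * N)
  D = p * k * N - E
  a<D : a < D
  a<D = begin-strict
    a                                   ≡⟨ solve 2 (λ a E → a := a :+ E :- E) refl a E ⟩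
    a + E - E                           <⟨ ℚP.+-monoˡ-< (- E) (ℚP.+-monoʳ-< a E<kB) ⟩
    a + k * ((1ℚ - c) * p * N) - E      ≡⟨ solve 5 (λ c p k N E →
                                              c :* p :* (k :* N) :+ k :* ((con 1ℚ :- c) :* p :* N) :- E
                                           := p :* k :* N :- E) refl c p k N E ⟩
    D                                   ∎

largest-fibre : ∀ {n t} .{{_ : NonZero t}} → 0 ℕ.< n → (f : Fin n → Fin t) →
  Σ (Fin t) (λ i → n ℕ.≤ t ℕ.* card (fibre f i) × 0 ℕ.< card (fibre f i))
largest-fibre {n} {t} 0<n f with sumFin≤t*largest t (card ∘ fibre f)
... | i , ∑≤t*Ki = i , n≤t*Ki , 0<Ki
  where
  n≤t*Ki : n ℕ.≤ t ℕ.* card (fibre f i)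
  n≤t*Ki = subst (ℕ._≤ t ℕ.* card (fibre f i)) (sumFin-card-fibre f) ∑≤t*Ki
  0<Ki : 0 ℕ.< card (fibre f i)
  0<Ki = ℕ.>-nonZero⁻¹ _ {{ℕP.m*n≢0⇒n≢0 t {{ℕ.>-nonZero (ℕP.<-≤-trans 0<n n≤t*Ki)}}}}

low-degree-set-bound : ∀ {n c p β} → 0ℚ ≤ c * p → (G : Graph n) → Jumbled p β G →
  (X : Subset n) → 0 ℕ.< card X →
  (∀ x → lookup X x ≡ true → ℕ→ℚ (deg G x) < (1ℚ - c) * p * ℕ→ℚ n) →
  c * p * (c * p) * (ℕ→ℚ (card X) * ℕ→ℚ n) < β * β
low-degree-set-bound {n} {c} {p} {β} 0≤cp G jumbled X 0<∣X∣ low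
  with card-pos⇒∃ X 0<∣X∣
... | x₀ , x₀∈X = deficit⇒c²p²kN<β² {c} {p} {β} {ℕ→ℚ (e G X ⊤)} {ℕ→ℚ (card X)} {ℕ→ℚ n}
                    0≤cp 0<kN (Jumbled⇒deviation[X,⊤] {p = p} {β} G jumbled X)
                    (e[X,⊤]<card*B G X _ low x₀ x₀∈X)
  where
  0<kN : 0ℚ < ℕ→ℚ (card X) * ℕ→ℚ n
  0<kN = *-pos (ℕ→ℚ-mono-< 0<∣X∣) (ℕ→ℚ-mono-< (ℕP.≤-<-trans ℕ.z≤n (FinP.toℕ<n x₀)))

large-class⇒[cpN]²<Tβ² : ∀ {c p β T k N} → 0ℚ < T → 0ℚ ≤ c * p → 0ℚ ≤ N → N ≤ T * k →
  c * p * (c * p) * (k * N) < β * β → (c * p * N) * (c * p * N) < T * (β * β)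
large-class⇒[cpN]²<Tβ² {c} {p} {β} {T} {k} {N} 0<T 0≤cp 0≤N N≤Tk class-bound = begin-strict
  c * p * N * (c * p * N)            ≡⟨ solve 3 (λ c p N →
                                            c :* p :* N :* (c :* p :* N)
                                         := c :* p :* (c :* p) :* (N :* N)) refl c p N ⟩
  c * p * (c * p) * (N * N)          ≤⟨ ℚP.*-monoˡ-≤-nonNeg (c * p * (c * p))
                                          {{ℚ.nonNegative (*-nonNeg 0≤cp 0≤cp)}}
                                          (ℚP.*-monoʳ-≤-nonNeg N {{ℚ.nonNegative 0≤N}} N≤Tk) ⟩
  c * p * (c * p) * (T * k * N)      ≡⟨ solve 5 (λ c p T k N →
                                            c :* p :* (c :* p) :* (T :* k :* N)
                                         := T :* (c :* p :* (c :* p) :* (k :* N))) refl c p T k N ⟩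
  T * (c * p * (c * p) * (k * N))    <⟨ ℚP.*-monoʳ-<-pos T {{ℚ.positive 0<T}} class-bound ⟩
  T * (β * β)                        ∎
  where
  open ℚP.≤-Reasoning
  open +-*-Solver

no-low-degree-cover : ∀ {c p β t n} .{{_ : NonZero t}} → 0ℚ < c → 0ℚ < p →
  (G : Fin t → Graph n) → (∀ i → Jumbled p β (G i)) →
  ℕ→ℚ t * (β * β) ≤ (c * p * ℕ→ℚ n) * (c * p * ℕ→ℚ n) → 0 ℕ.< n →
  (low : Fin n → Fin t) → (∀ v → ℕ→ℚ (deg (G (low v)) v) < (1ℚ - c) * p * ℕ→ℚ n) → ⊥
no-low-degree-cover {c} {p} {β} {t} {n} 0<c 0<p G jumbled tβ²≤[cpn]² 0<n low low-degree
  with largest-fibre 0<n low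
... | i , n≤t*Ki , 0<Ki = ℚP.<-irrefl refl (ℚP.<-≤-trans [cpn]²<tβ² tβ²≤[cpn]²)
  where
  N : ℚ
  N = ℕ→ℚ n
  0≤cp : 0ℚ ≤ c * p
  0≤cp = ℚP.<⇒≤ (*-pos 0<c 0<p)
  N≤Tk : N ≤ ℕ→ℚ t * ℕ→ℚ (card (fibre low i))
  N≤Tk = ℚP.≤-trans (ℕ→ℚ-mono-≤ n≤t*Ki) (ℚP.≤-reflexive (ℕ→ℚ-* t _))
  low-in-class : ∀ x → lookup (fibre low i) x ≡ true → ℕ→ℚ (deg (G i) x) < (1ℚ - c) * p * N
  low-in-class x x∈ = subst (λ j → ℕ→ℚ (deg (G j) x) < (1ℚ - c) * p * N)
    (fibre-sound low i x x∈) (low-degree x)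
  class-bound : c * p * (c * p) * (ℕ→ℚ (card (fibre low i)) * N) < β * β
  class-bound = low-degree-set-bound {c = c} {p} {β} 0≤cp (G i) (jumbled i)
                  (fibre low i) 0<Ki low-in-class
  [cpn]²<tβ² : (c * p * N) * (c * p * N) < ℕ→ℚ t * (β * β)
  [cpn]²<tβ² = large-class⇒[cpN]²<Tβ² {c} {p} {β}
    (ℕ→ℚ-mono-< (ℕ.>-nonZero⁻¹ t)) 0≤cp (ℕ→ℚ-mono-≤ {b = n} ℕ.z≤n) N≤Tk class-bound

vertex-set-nonempty : ∀ {c p β t n} .{{_ : NonZero t}} → 0ℚ < β →
  ℕ→ℚ t * (β * β) ≤ (c * p * ℕ→ℚ n) * (c * p * ℕ→ℚ n) → 0 ℕ.< n
vertex-set-nonempty {n = suc _} _ _ = ℕ.z<s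
vertex-set-nonempty {c} {p} {β} {t} {zero} 0<β tβ²≤[cp0]² = ⊥-elim (ℚP.<-irrefl refl (begin-strict
  0ℚ                        <⟨ *-pos (ℕ→ℚ-mono-< (ℕ.>-nonZero⁻¹ t)) (*-pos 0<β 0<β) ⟩
  ℕ→ℚ t * (β * β)           ≤⟨ tβ²≤[cp0]² ⟩
  c * p * 0ℚ * (c * p * 0ℚ) ≡⟨ solve 2 (λ c p → c :* p :* con 0ℚ :* (c :* p :* con 0ℚ) := con 0ℚ)
                                      refl c p ⟩
  0ℚ                        ∎))
  where
  open ℚP.≤-Reasoning
  open +-*-Solver

lemma3p5 : (c p β : ℚ) → 0ℚ < c → c < 1ℚ → 0ℚ < p → p < 1ℚ → 1ℚ ≤ β →
    (t : ℕ) → .{{_ : NonZero t}} → (n : ℕ) → (G : Fin t → Graph n) →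
    (∀ i → Jumbled p β (G i)) →
    ℕ→ℚ t * (β * β) ≤ (c * p * ℕ→ℚ n) * (c * p * ℕ→ℚ n) →
    Σ (Fin n) (λ v → ∀ i → (1ℚ - c) * p * ℕ→ℚ n ≤ ℕ→ℚ (deg (G i) v))
lemma3p5 c p β 0<c _ 0<p _ 1≤β t n G jumbled tβ²≤[cpn]²
  with ∃∀⊎∀∃¬ (λ v i → (1ℚ - c) * p * ℕ→ℚ n ℚP.≤? ℕ→ℚ (deg (G i) v))
... | inj₁ high-everywhere = high-everywhere
... | inj₂ (low , not-high) = ⊥-elim (no-low-degree-cover {β = β} 0<c 0<p G jumbled tβ²≤[cpn]²
                                (vertex-set-nonempty {c = c} {p} 0<β tβ²≤[cpn]²)
                                low (ℚP.≰⇒> ∘ not-high))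
  where
  0<β : 0ℚ < β
  0<β = ℚP.<-≤-trans (ℚP.positive⁻¹ 1ℚ) 1≤β
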